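{- For every $a, b \in \Lambda_{\mathrm{dB}}$, $n \in \mathbb{N}$ and $i \in \mathbb{N}_{>0}$: (1) $\mathrm{SW}_i^n(a\,b) = \mathrm{SW}_i^n(a)\,\mathrm{SW}_i^n(b)$; (2) $\mathrm{SW}_i^n(\lambda a) = \lambda\,\mathrm{SW}_{i+1}^n(a)$; (3) $\big(\lambda\,\mathrm{SW}_2^n(a)\big)\big[\mathrm{INC}^n(b)\big] = \lambda\Big(\mathrm{SW}_1^{n+1}(a)\big[\mathrm{INC}^{n+1}(b)\big]\Big)$.
   Context: $\Lambda_{\mathrm{dB}}$ is the set of de Bruijn terms given by $a ::= n \mid a\,a \mid \lambda a$ with $n \in \mathbb{N}_{>0}$. Increment: for $i\in\mathbb{N}$, $\mathrm{inc}_i(n)=n$ if $n\le i$ and $n+1$ if $n>i$; $\mathrm{inc}_i(a\,b)=\mathrm{inc}_i(a)\,\mathrm{inc}_i(b)$; $\mathrm{inc}_i(\lambda a)=\lambda\,\mathrm{inc}_{i+1}(a)$. Swap: for $i\in\mathbb{N}_{>0}$, $\mathrm{sw}_i(n)=n$ if $n<i$ or $n>i+1$, $\mathrm{sw}_i(i)=i+1$, $\mathrm{sw}_i(i+1)=i$; $\mathrm{sw}_i(a\,b)=\mathrm{sw}_i(a)\,\mathrm{sw}_i(b)$; $\mathrm{sw}_i(\lambda a)=\lambda\,\mathrm{sw}_{i+1}(a)$. $\lambda r$ meta-substitution $a[c]$: $1[c]=c$, $n[c]=n-1$ for $n>1$; $(a\,b)[c]=a[c]\,b[c]$; $(\lambda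 a)[c]=\lambda\big(\mathrm{sw}_1(a)[\mathrm{inc}_0(c)]\big)$. Stacked swap: for $i\in\mathbb{N}_{>0}$, $j\in\mathbb{N}$, $\mathrm{SW}_i^0(a)=a$ and $\mathrm{SW}_i^j(a)=\mathrm{SW}_i^{j-1}(\mathrm{sw}_{i+j-1}(a))$ for $j>0$. Stacked increment: for $i\in\mathbb{N}$, $\mathrm{INC}^0(a)=a$ and $\mathrm{INC}^i(a)=\mathrm{INC}^{i-1}(\mathrm{inc}_0(a))$ for $i>0$. -}

module Defs where

open import Data.Nat using (ℕ; zero; suc; _+_; _∸_; _<ᵇ_; _≡ᵇ_; NonZero)
open import Data.Bool using (Bool; true; false; if_then_else_)

data Λ : Set where
  var : (n : ℕ) → .{{_ : NonZero n}} → Λ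
  app : Λ → Λ → Λ
  lam : Λ → Λ

inc : ℕ → Λ → Λ
inc i (var n) with i Data.Nat.<ᵇ n
... | true  = var (suc n)
... | false = var n
inc i (app a b) = app (inc i a) (inc i b)
inc i (lam a)   = lam (inc (suc i) a)

sw : (i : ℕ) → .{{_ : NonZero i}} → Λ → Λ
sw i (var n) with n ≡ᵇ i | n ≡ᵇ suc i
... | true  | _     = var (suc i)
... | false | true  = var i
... | false | false = var n
sw i (app a b) = app (sw i a) (sw i b)
sw i (lam a)   = lam (sw (suc i) a)

-- size of a term (sw preserves it; used only as fuel to make the
-- recursion of the meta-substitution structurally terminating)
size : Λ → ℕ
size (var n)   = 1
size (app a b) = suc (size a + size b)
size (lam a)   = suc (size a)

-- λr meta-substitution with fuel; fuel ≥ size a always suffices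
subst-fuel : ℕ → Λ → Λ → Λ
subst-fuel zero    a c = a   -- unreachable when fuel ≥ size a
subst-fuel (suc k) (var 1) c = c
subst-fuel (suc k) (var (suc (suc m))) c = var (suc m)
subst-fuel (suc k) (app a b) c = app (subst-fuel k a c) (subst-fuel k b c)
subst-fuel (suc k) (lam a) c = lam (subst-fuel k (sw 1 a) (inc 0 c))

_[_] : Λ → Λ → Λ
a [ c ] = subst-fuel (size a) a c

SW : (i : ℕ) → .{{_ : NonZero i}} → ℕ → Λ → Λ
SW i zero a = a
SW (suc k) (suc j) a = SW (suc k) j (sw (suc (k + j)) a)

INC : ℕ → Λ → Λ
INC zero a = a
INC (suc i) a = INC i (inc 0 a)

module Submission where

open import Defs
open import Data.Nat using (ℕ; zero; suc; NonZero; _+_; _≡ᵇ_)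
open import Data.Nat.Properties using (+-identityʳ; +-suc)
open import Data.Bool using (true; false)
open import Data.Product using (_×_; _,_)
open import Relation.Binary.PropositionalEquality hiding ([_])
open ≡-Reasoning

size-sw : (i : ℕ) .{{_ : NonZero i}} (a : Λ) → size (sw i a) ≡ size a
size-sw i (var n) with n ≡ᵇ i | n ≡ᵇ suc i
... | true  | _     = refl
... | false | true  = refl
... | false | false = refl
size-sw i (app a b) = cong₂ (λ x y → suc (x + y)) (size-sw i a) (size-sw i b)
size-sw i (lam a)   = cong suc (size-sw (suc i) a)

-- The fuel size (lam a) = suc (size a) matches size (sw 1 a) only up to size-sw.
lam-[] : (a c : Λ) → lam a [ c ] ≡ lam (sw 1 a [ inc 0 c ])
lam-[] a c = cong (λ k → lam (subst-fuel k (sw 1 a) (inc 0 c))) (sym (size-sw 1 a))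

SW-app : (i n : ℕ) .{{_ : NonZero i}} (a b : Λ) →
         SW i n (app a b) ≡ app (SW i n a) (SW i n b)
SW-app (suc k) zero    a b = refl
SW-app (suc k) (suc n) a b = SW-app (suc k) n _ _

SW-lam : (i n : ℕ) .{{_ : NonZero i}} (a : Λ) → SW i n (lam a) ≡ lam (SW (suc i) n a)
SW-lam (suc k) zero    a = refl
SW-lam (suc k) (suc n) a = SW-lam (suc k) n _

sw-SW-suc : (i n : ℕ) .{{_ : NonZero i}} (a : Λ) → sw i (SW (suc i) n a) ≡ SW i (suc n) a
sw-SW-suc (suc k) zero    a = cong (λ m → sw (suc m) a) (sym (+-identityʳ k))
sw-SW-suc (suc k) (suc n) a = begin
  sw (suc k) (SW (suc (suc k)) n (sw (suc (suc k + n)) a)) ≡⟨ sw-SW-suc (suc k) n _ ⟩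
  SW (suc k) (suc n) (sw (suc (suc k + n)) a)              ≡⟨ cong (λ m → SW (suc k) (suc n) (sw (suc m) a)) (sym (+-suc k n)) ⟩
  SW (suc k) (suc n) (sw (suc (k + suc n)) a)              ∎

INC-inc₀ : (n : ℕ) (b : Λ) → INC n (inc 0 b) ≡ inc 0 (INC n b)
INC-inc₀ zero    b = refl
INC-inc₀ (suc n) b = INC-inc₀ n (inc 0 b)

lemma14 : (a b : Λ) (n i : ℕ) .{{_ : NonZero i}} →
    (SW i n (app a b) ≡ app (SW i n a) (SW i n b))
    × (SW i n (lam a) ≡ lam (SW (suc i) n a))
    × ((lam (SW 2 n a) [ INC n b ]) ≡ lam (SW 1 (suc n) a [ INC (suc n) b ]))
lemma14 a b n i = SW-app i n a b , SW-lam i n a , substitution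
  where
  substitution : lam (SW 2 n a) [ INC n b ] ≡ lam (SW 1 (suc n) a [ INC (suc n) b ])
  substitution = begin
    lam (SW 2 n a) [ INC n b ]                  ≡⟨ lam-[] (SW 2 n a) (INC n b) ⟩
    lam (sw 1 (SW 2 n a) [ inc 0 (INC n b) ])   ≡⟨ cong₂ (λ x y → lam (x [ y ])) (sw-SW-suc 1 n a) (sym (INC-inc₀ n b)) ⟩
    lam (SW 1 (suc n) a [ INC (suc n) b ])      ∎
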